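{- Let $D=(E,\mathcal{F})$ and $\widetilde{D}=(\widetilde{E},\widetilde{\mathcal{F}})$ be set systems with $E\cap\widetilde{E}=\emptyset$. Then for every $\bullet\in\mathcal{B}$: (1) ${}^{\partial}w_{D}^{\bullet}(1)=2^{|E|}$; (2) ${}^{\partial}w_{D}^{\bullet}(z)$ has degree at most $|E|$; (3) ${}^{\partial}w_{D\oplus\widetilde{D}}^{\bullet}(z)={}^{\partial}w_{D}^{\bullet}(z)\,{}^{\partial}w_{\widetilde{D}}^{\bullet}(z)$.
   Context: A set system is a pair $D=(E,\mathcal{F})$ with $E$ a finite set and $\mathcal{F}$ a collection of subsets of $E$ (feasible sets). The direct sum of set systems with disjoint ground sets is $D\oplus\widetilde{D}=(E\cup\widetilde{E},\{F\cup\widetilde{F}:F\in\mathcal{F},\widetilde{F}\in\widetilde{\mathcal{F}}\})$. The width $w(D)$ is the size of a largest feasible set minus the size of a smallest feasible set. For $A\subseteq E$, the twist is $D^{*|A}=(E,\{A\Delta X:X\in\mathcal{F}\})$. For $e\in E$, $D^{\times|e}=(E,\mathcal{F}\Delta\{F\cup e:F\in\mathcal{F}, e\notin F\})$ (loop complementation). For a word $a=a_1\cdots a_n$ in $\{*,\times\}$ and $e\in E$, $D^{a|e}$ is obtained by applying $a_1|e$, then $a_2|e$, …, then $a_n|e$; for $A=\{e_1,\dots,e_m\}$, $D^{a|A}$ is obtained by applying $a|e_1$, then $a|e_2$, …, $a|e_m$ (well-defined since operations on distinct elements commute). These operations give an action of $\mathcal{B}=\langle *,\times\mid *^2,\times^2,(*\times)^3\rangle\cong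 S_3$. For $\bullet\in\mathcal{B}$, the partial-$\bullet$ polynomial is ${}^{\partial}w_{D}^{\bullet}(z)=\sum_{A\subseteq E}z^{w(D^{\bullet|A})}$. -}

module Defs where

open import Data.Nat using (ℕ; zero; suc; _+_; _*_; _∸_; _⊔_; _⊓_)
open import Data.Bool using (Bool; true; false; if_then_else_; _∧_; _xor_)
open import Data.Fin using (Fin)
open import Data.Fin.Subset using (Subset; ∣_∣; ⁅_⁆)
open import Data.Vec using (Vec; []; _∷_; lookup; zipWith; take; drop; _++_)
open import Data.List using (List; []; _∷_; map; foldr; concatMap; sum; replicate; allFin)
open import Data.Product using (∃)
open import Relation.Binary.PropositionalEquality using (_≡_)

record SetSystem (n : ℕ) : Set where
  constructor mkSS
  field
    feasible : Subset n → Bool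
open SetSystem public

NonEmpty : ∀ {n} → SetSystem n → Set
NonEmpty D = ∃ λ X → feasible D X ≡ true

allSubsets : (n : ℕ) → List (Subset n)
allSubsets zero = [] ∷ []
allSubsets (suc n) = concatMap (λ X → (false ∷ X) ∷ (true ∷ X) ∷ []) (allSubsets n)

_Δ_ : ∀ {n} → Subset n → Subset n → Subset n
A Δ B = zipWith _xor_ A B

feasibleSizes : ∀ {n} → SetSystem n → List ℕ
feasibleSizes {n} D =
  foldr (λ X acc → if feasible D X then ∣ X ∣ ∷ acc else acc) [] (allSubsets n)

maxFeasible : ∀ {n} → SetSystem n → ℕ
maxFeasible D = foldr _⊔_ 0 (feasibleSizes D)

-- every subset of Fin n has size ≤ n, so n is a neutral start for the minimum
minFeasible : ∀ {n} → SetSystem n → ℕ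
minFeasible {n} D = foldr _⊓_ n (feasibleSizes D)

width : ∀ {n} → SetSystem n → ℕ
width D = maxFeasible D ∸ minFeasible D

twistAt : ∀ {n} → Fin n → SetSystem n → SetSystem n
twistAt e D = mkSS (λ X → feasible D (X Δ ⁅ e ⁆))

twist : ∀ {n} → Subset n → SetSystem n → SetSystem n
twist A D = mkSS (λ X → feasible D (A Δ X))

-- D^{×|e} = (E, F Δ {F ∪ e : F ∈ F, e ∉ F}):
-- X with e ∉ X is feasible iff X ∈ F;
-- X with e ∈ X is feasible iff (X ∈ F) xor (X - e ∈ F).
loopCompAt : ∀ {n} → Fin n → SetSystem n → SetSystem n
loopCompAt e D =
  mkSS (λ X → if lookup X e
               then feasible D X xor feasible D (X Δ ⁅ e ⁆)
               else feasible D X)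

data Op : Set where
  star times : Op

-- elements of B are represented by words in {*, ×}
Word : Set
Word = List Op

applyOpAt : ∀ {n} → Op → Fin n → SetSystem n → SetSystem n
applyOpAt star  e D = twistAt e D
applyOpAt times e D = loopCompAt e D

applyWordAt : ∀ {n} → Word → Fin n → SetSystem n → SetSystem n
applyWordAt []       e D = D
applyWordAt (o ∷ os) e D = applyWordAt os e (applyOpAt o e D)

-- D^{a|A}: apply a|e for each e ∈ A (in increasing order of e)
applyWordOn : ∀ {n} → Word → Subset n → SetSystem n → SetSystem n
applyWordOn {n} a A D =
  foldr (λ e D' → if lookup A e then applyWordAt a e D' else D') D
        (Data.List.reverse (allFin n))

-- Direct sum: ground set Fin n ⊎ Fin m laid out as Fin (n + m)
-- (first n positions = E, last m positions = Ẽ, disjoint).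

_⊕_ : ∀ {n m} → SetSystem n → SetSystem m → SetSystem (n + m)
_⊕_ {n} D D' = mkSS (λ X → feasible D (take n X) ∧ feasible D' (drop n X))

-- Polynomials with natural-number coefficients as coefficient lists
-- (index i = coefficient of z^i; trailing zeros allowed).

Poly : Set
Poly = List ℕ

coeff : Poly → ℕ → ℕ
coeff []       k       = 0
coeff (c ∷ p)  zero    = c
coeff (c ∷ p)  (suc k) = coeff p k

_+ₚ_ : Poly → Poly → Poly
[]      +ₚ q       = q
(a ∷ p) +ₚ []      = a ∷ p
(a ∷ p) +ₚ (b ∷ q) = (a + b) ∷ (p +ₚ q)

scaleₚ : ℕ → Poly → Poly
scaleₚ c p = map (c *_) p

_*ₚ_ : Poly → Poly → Poly
[]      *ₚ q = []
(a ∷ p) *ₚ q = scaleₚ a q +ₚ (0 ∷ (p *ₚ q))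

monomial : ℕ → Poly
monomial k = replicate k 0 Data.List.++ (1 ∷ [])

eval : Poly → ℕ → ℕ
eval p z = foldr (λ c acc → c + z * acc) 0 p

_≈ₚ_ : Poly → Poly → Set
p ≈ₚ q = ∀ k → coeff p k ≡ coeff q k

-- degree at most d (the zero polynomial has degree at most every d)
DegreeAtMost : Poly → ℕ → Set
DegreeAtMost p d = ∀ k → d Data.Nat.< k → coeff p k ≡ 0

partialPoly : ∀ {n} → SetSystem n → Word → Poly
partialPoly {n} D a =
  foldr (λ A acc → monomial (width (applyWordOn a A D)) +ₚ acc) [] (allSubsets n)

{-# OPTIONS --safe #-}
-- The partial polynomial is a sum of 2^n monomials z^w with w ≤ n, which gives
-- (1) and (2). For (3): twisting and loop complementation at e are local (the
-- feasibility of X afterwards depends only on e ∈ X and on the feasibility of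
-- X and X Δ {e}), so at an element of one summand of D ⊕ D′ they act on that
-- summand alone, and (D ⊕ D′)^{•|A ∪ B} = D^{•|A} ⊕ D′^{•|B}. Both operations
-- preserve nonemptiness, and for nonempty systems the largest and smallest
-- feasible sizes of a direct sum are the sums of those of the summands, so the
-- widths add and the sum over subsets of E ∪ E′ factors into the product.
module Submission where

open import Defs
open import Data.Bool using (Bool; true; false; not; if_then_else_; _∧_; _xor_)
open import Data.Bool.Properties
  using (∧-conicalˡ; ∧-conicalʳ; ∧-distribˡ-xor; ∧-distribʳ-xor; xor-assoc; xor-same; xor-identityʳ)
open import Data.Fin using (Fin; zero; suc; _↑ˡ_; _↑ʳ_)
open import Data.Fin.Subset using (Subset; ∣_∣; ⁅_⁆; ⊥)
open import Data.Fin.Subset.Properties using (∣p∣≤n)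
open import Data.List using (List; []; _∷_; _++_; foldr; map; concatMap; length; reverse; allFin; tabulate)
open import Data.List.Membership.Propositional using (_∈_)
open import Data.List.Membership.Propositional.Properties using (∈-concatMap⁺; foldr-selective)
open import Data.List.Properties
  using (foldr-cong; foldr-preservesᵒ; foldr-++; reverse-++; reverse-map; map-tabulate)
import Data.List.Relation.Unary.Any as Any
open import Data.List.Relation.Unary.Any using (here; there)
open import Data.Nat using (ℕ; zero; suc; _+_; _*_; _∸_; _^_; _⊔_; _⊓_; _≤_; z≤n; s≤s)
open import Data.Nat.Properties
open import Algebra.Properties.CommutativeSemigroup +-commutativeSemigroup
  using () renaming (interchange to +-interchange)
open import Data.Product using (_×_; _,_; ∃)
open import Data.Sum using (inj₁; inj₂; [_,_])
open import Data.Vec using ([]; _∷_; lookup; take; drop) renaming (_++_ to _++ᵥ_)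
open import Data.Vec.Properties using (take++drop≡id; lookup-++ˡ; lookup-++ʳ)
open import Function using (_∘_; id)
open import Level using (0ℓ)
open import Relation.Binary using (Setoid)
import Relation.Binary.Reasoning.Setoid as SetoidReasoning
open import Relation.Binary.PropositionalEquality
  using (_≡_; refl; sym; trans; cong; cong₂; subst; module ≡-Reasoning)

-- _≈ₚ_ unfolds to a Π-type, from which Agda cannot infer the compared
-- polynomials; this record wrapper makes them inferable.
infix 4 _≋_
record _≋_ (p q : Poly) : Set where
  constructor coeffwise
  field ≋⇒≈ₚ : p ≈ₚ q
open _≋_

≋-refl : ∀ {p} → p ≋ p
≋-refl = coeffwise λ _ → refl

≋-sym : ∀ {p q} → p ≋ q → q ≋ p
≋-sym (coeffwise p≈q) = coeffwise λ k → sym (p≈q k)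

≋-trans : ∀ {p q r} → p ≋ q → q ≋ r → p ≋ r
≋-trans (coeffwise p≈q) (coeffwise q≈r) = coeffwise λ k → trans (p≈q k) (q≈r k)

≋-reflexive : ∀ {p q} → p ≡ q → p ≋ q
≋-reflexive refl = ≋-refl

≋-setoid : Setoid 0ℓ 0ℓ
≋-setoid = record
  { Carrier       = Poly
  ; _≈_           = _≋_
  ; isEquivalence = record { refl = ≋-refl ; sym = ≋-sym ; trans = ≋-trans }
  }

module ≋-Reasoning = SetoidReasoning ≋-setoid

coeff-+ₚ : ∀ p q k → coeff (p +ₚ q) k ≡ coeff p k + coeff q k
coeff-+ₚ []      q       k       = refl
coeff-+ₚ (a ∷ p) []      k       = sym (+-identityʳ _)
coeff-+ₚ (a ∷ p) (b ∷ q) zero    = refl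
coeff-+ₚ (a ∷ p) (b ∷ q) (suc k) = coeff-+ₚ p q k

coeff-scaleₚ : ∀ c p k → coeff (scaleₚ c p) k ≡ c * coeff p k
coeff-scaleₚ c []      k       = sym (*-zeroʳ c)
coeff-scaleₚ c (a ∷ p) zero    = refl
coeff-scaleₚ c (a ∷ p) (suc k) = coeff-scaleₚ c p k

+ₚ-identityʳ : ∀ p → p +ₚ [] ≡ p
+ₚ-identityʳ []      = refl
+ₚ-identityʳ (a ∷ p) = refl

+ₚ-cong : ∀ {p p′ q q′} → p ≋ p′ → q ≋ q′ → (p +ₚ q) ≋ (p′ +ₚ q′)
+ₚ-cong {p} {p′} {q} {q′} (coeffwise p≈p′) (coeffwise q≈q′) = coeffwise λ k → begin
  coeff (p +ₚ q) k        ≡⟨ coeff-+ₚ p q k ⟩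
  coeff p k + coeff q k   ≡⟨ cong₂ _+_ (p≈p′ k) (q≈q′ k) ⟩
  coeff p′ k + coeff q′ k ≡⟨ coeff-+ₚ p′ q′ k ⟨
  coeff (p′ +ₚ q′) k      ∎
  where open ≡-Reasoning

+ₚ-assoc : ∀ p q r → ((p +ₚ q) +ₚ r) ≋ (p +ₚ (q +ₚ r))
+ₚ-assoc p q r = coeffwise λ k → begin
  coeff ((p +ₚ q) +ₚ r) k                 ≡⟨ coeff-+ₚ (p +ₚ q) r k ⟩
  coeff (p +ₚ q) k + coeff r k            ≡⟨ cong (_+ coeff r k) (coeff-+ₚ p q k) ⟩
  (coeff p k + coeff q k) + coeff r k     ≡⟨ +-assoc (coeff p k) (coeff q k) (coeff r k) ⟩
  coeff p k + (coeff q k + coeff r k)     ≡⟨ cong (coeff p k +_) (coeff-+ₚ q r k) ⟨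
  coeff p k + coeff (q +ₚ r) k            ≡⟨ coeff-+ₚ p (q +ₚ r) k ⟨
  coeff (p +ₚ (q +ₚ r)) k                 ∎
  where open ≡-Reasoning

+ₚ-interchange : ∀ p q r s → ((p +ₚ q) +ₚ (r +ₚ s)) ≋ ((p +ₚ r) +ₚ (q +ₚ s))
+ₚ-interchange p q r s = coeffwise λ k → begin
  coeff ((p +ₚ q) +ₚ (r +ₚ s)) k                          ≡⟨ coeff-+ₚ² p q r s k ⟩
  (coeff p k + coeff q k) + (coeff r k + coeff s k)       ≡⟨ +-interchange (coeff p k) _ _ _ ⟩
  (coeff p k + coeff r k) + (coeff q k + coeff s k)       ≡⟨ coeff-+ₚ² p r q s k ⟨
  coeff ((p +ₚ r) +ₚ (q +ₚ s)) k                          ∎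
  where
  open ≡-Reasoning
  coeff-+ₚ² : ∀ a b c d k → coeff ((a +ₚ b) +ₚ (c +ₚ d)) k
                          ≡ (coeff a k + coeff b k) + (coeff c k + coeff d k)
  coeff-+ₚ² a b c d k =
    trans (coeff-+ₚ (a +ₚ b) (c +ₚ d) k) (cong₂ _+_ (coeff-+ₚ a b k) (coeff-+ₚ c d k))

∷-congₚ : ∀ c {p q} → p ≋ q → (c ∷ p) ≋ (c ∷ q)
∷-congₚ c (coeffwise p≈q) = coeffwise λ where
  zero    → refl
  (suc k) → p≈q k

0∷[]≋[] : (0 ∷ []) ≋ []
0∷[]≋[] = coeffwise λ where
  zero    → refl
  (suc k) → refl

coeff-∷-*ₚ : ∀ a p r k → coeff ((a ∷ p) *ₚ r) k ≡ a * coeff r k + coeff (0 ∷ (p *ₚ r)) k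
coeff-∷-*ₚ a p r k =
  trans (coeff-+ₚ (scaleₚ a r) (0 ∷ (p *ₚ r)) k) (cong (_+ _) (coeff-scaleₚ a r k))

-- The second step uses that 0 ∷ (s +ₚ t) and (0 ∷ s) +ₚ (0 ∷ t) agree by
-- computation, since 0 + 0 reduces to 0.
*ₚ-distribʳ-+ₚ : ∀ p q r → ((p +ₚ q) *ₚ r) ≋ ((p *ₚ r) +ₚ (q *ₚ r))
*ₚ-distribʳ-+ₚ []      q       r = ≋-refl
*ₚ-distribʳ-+ₚ (a ∷ p) []      r rewrite +ₚ-identityʳ ((a ∷ p) *ₚ r) = ≋-refl
*ₚ-distribʳ-+ₚ (a ∷ p) (b ∷ q) r = coeffwise λ k → begin
  coeff ((a + b ∷ (p +ₚ q)) *ₚ r) k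
    ≡⟨ coeff-∷-*ₚ (a + b) (p +ₚ q) r k ⟩
  (a + b) * coeff r k + coeff (0 ∷ ((p +ₚ q) *ₚ r)) k
    ≡⟨ cong₂ _+_ (*-distribʳ-+ (coeff r k) a b)
                 (trans (≋⇒≈ₚ (∷-congₚ 0 (*ₚ-distribʳ-+ₚ p q r)) k)
                        (coeff-+ₚ (0 ∷ (p *ₚ r)) (0 ∷ (q *ₚ r)) k)) ⟩
  (a * coeff r k + b * coeff r k) + (coeff (0 ∷ (p *ₚ r)) k + coeff (0 ∷ (q *ₚ r)) k)
    ≡⟨ +-interchange (a * coeff r k) _ _ _ ⟩
  (a * coeff r k + coeff (0 ∷ (p *ₚ r)) k) + (b * coeff r k + coeff (0 ∷ (q *ₚ r)) k)
    ≡⟨ cong₂ _+_ (coeff-∷-*ₚ a p r k) (coeff-∷-*ₚ b q r k) ⟨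
  coeff ((a ∷ p) *ₚ r) k + coeff ((b ∷ q) *ₚ r) k
    ≡⟨ coeff-+ₚ ((a ∷ p) *ₚ r) ((b ∷ q) *ₚ r) k ⟨
  coeff (((a ∷ p) *ₚ r) +ₚ ((b ∷ q) *ₚ r)) k ∎
  where open ≡-Reasoning

monomial-zero-*ₚ : ∀ q → (monomial 0 *ₚ q) ≋ q
monomial-zero-*ₚ q = coeffwise λ k → begin
  coeff (monomial 0 *ₚ q) k            ≡⟨ coeff-∷-*ₚ 1 [] q k ⟩
  1 * coeff q k + coeff (0 ∷ []) k     ≡⟨ cong₂ _+_ (*-identityˡ (coeff q k)) (≋⇒≈ₚ 0∷[]≋[] k) ⟩
  coeff q k + 0                        ≡⟨ +-identityʳ (coeff q k) ⟩
  coeff q k                            ∎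
  where open ≡-Reasoning

monomial-suc-*ₚ : ∀ j q → (monomial (suc j) *ₚ q) ≋ (0 ∷ (monomial j *ₚ q))
monomial-suc-*ₚ j q = coeffwise (coeff-∷-*ₚ 0 (monomial j) q)

private variable X Y : Set

sumₚ : List X → (X → Poly) → Poly
sumₚ xs f = foldr (λ x acc → f x +ₚ acc) [] xs

sumₚ-cong : ∀ (xs : List X) {f g : X → Poly} → (∀ x → f x ≋ g x) → sumₚ xs f ≋ sumₚ xs g
sumₚ-cong []       f≈g = ≋-refl
sumₚ-cong (x ∷ xs) f≈g = +ₚ-cong (f≈g x) (sumₚ-cong xs f≈g)

sumₚ-pairs : ∀ (xs : List X) (a b : X → Y) (f : Y → Poly) →
             sumₚ (concatMap (λ x → a x ∷ b x ∷ []) xs) f ≋ (sumₚ xs (f ∘ a) +ₚ sumₚ xs (f ∘ b))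
sumₚ-pairs []       a b f = ≋-refl
sumₚ-pairs (x ∷ xs) a b f = begin
  f (a x) +ₚ (f (b x) +ₚ sumₚ (concatMap (λ y → a y ∷ b y ∷ []) xs) f)
    ≈⟨ +ₚ-assoc (f (a x)) (f (b x)) _ ⟨
  (f (a x) +ₚ f (b x)) +ₚ sumₚ (concatMap (λ y → a y ∷ b y ∷ []) xs) f
    ≈⟨ +ₚ-cong ≋-refl (sumₚ-pairs xs a b f) ⟩
  (f (a x) +ₚ f (b x)) +ₚ (sumₚ xs (f ∘ a) +ₚ sumₚ xs (f ∘ b))
    ≈⟨ +ₚ-interchange (f (a x)) (f (b x)) _ _ ⟩
  (f (a x) +ₚ sumₚ xs (f ∘ a)) +ₚ (f (b x) +ₚ sumₚ xs (f ∘ b)) ∎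
  where open ≋-Reasoning

sumₚ-*ₚ : ∀ (xs : List X) (f : X → Poly) q → (sumₚ xs f *ₚ q) ≋ sumₚ xs (λ x → f x *ₚ q)
sumₚ-*ₚ []       f q = ≋-refl
sumₚ-*ₚ (x ∷ xs) f q = begin
  (f x +ₚ sumₚ xs f) *ₚ q           ≈⟨ *ₚ-distribʳ-+ₚ (f x) (sumₚ xs f) q ⟩
  (f x *ₚ q) +ₚ (sumₚ xs f *ₚ q)    ≈⟨ +ₚ-cong ≋-refl (sumₚ-*ₚ xs f q) ⟩
  (f x *ₚ q) +ₚ sumₚ xs (λ y → f y *ₚ q) ∎
  where open ≋-Reasoning

0∷-sumₚ : ∀ (xs : List X) (f : X → Poly) → (0 ∷ sumₚ xs f) ≋ sumₚ xs (λ x → 0 ∷ f x)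
0∷-sumₚ []       f = 0∷[]≋[]
0∷-sumₚ (x ∷ xs) f = +ₚ-cong ≋-refl (0∷-sumₚ xs f)

monomial-*ₚ-sumₚ : ∀ j (xs : List X) (g : X → ℕ) →
                   (monomial j *ₚ sumₚ xs (monomial ∘ g)) ≋ sumₚ xs (λ x → monomial (j + g x))
monomial-*ₚ-sumₚ zero    xs g = monomial-zero-*ₚ (sumₚ xs (monomial ∘ g))
monomial-*ₚ-sumₚ (suc j) xs g = begin
  monomial (suc j) *ₚ sumₚ xs (monomial ∘ g)   ≈⟨ monomial-suc-*ₚ j _ ⟩
  0 ∷ (monomial j *ₚ sumₚ xs (monomial ∘ g))   ≈⟨ ∷-congₚ 0 (monomial-*ₚ-sumₚ j xs g) ⟩
  0 ∷ sumₚ xs (λ x → monomial (j + g x))       ≈⟨ 0∷-sumₚ xs (λ x → monomial (j + g x)) ⟩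
  sumₚ xs (λ x → monomial (suc j + g x))       ∎
  where open ≋-Reasoning

sumₚ-monomial-*ₚ : ∀ (xs : List X) (ys : List Y) (f : X → ℕ) (g : Y → ℕ) →
                   (sumₚ xs (monomial ∘ f) *ₚ sumₚ ys (monomial ∘ g))
                     ≋ sumₚ xs (λ x → sumₚ ys (λ y → monomial (f x + g y)))
sumₚ-monomial-*ₚ xs ys f g = begin
  sumₚ xs (monomial ∘ f) *ₚ sumₚ ys (monomial ∘ g)
    ≈⟨ sumₚ-*ₚ xs (monomial ∘ f) _ ⟩
  sumₚ xs (λ x → monomial (f x) *ₚ sumₚ ys (monomial ∘ g))
    ≈⟨ sumₚ-cong xs (λ x → monomial-*ₚ-sumₚ (f x) ys g) ⟩
  sumₚ xs (λ x → sumₚ ys (λ y → monomial (f x + g y))) ∎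
  where open ≋-Reasoning

eval-+ₚ : ∀ p q z → eval (p +ₚ q) z ≡ eval p z + eval q z
eval-+ₚ []      q       z = refl
eval-+ₚ (a ∷ p) []      z = sym (+-identityʳ _)
eval-+ₚ (a ∷ p) (b ∷ q) z = begin
  (a + b) + z * eval (p +ₚ q) z           ≡⟨ cong (λ t → (a + b) + z * t) (eval-+ₚ p q z) ⟩
  (a + b) + z * (eval p z + eval q z)     ≡⟨ cong ((a + b) +_) (*-distribˡ-+ z (eval p z) (eval q z)) ⟩
  (a + b) + (z * eval p z + z * eval q z) ≡⟨ +-interchange a b _ _ ⟩
  (a + z * eval p z) + (b + z * eval q z) ∎
  where open ≡-Reasoning

eval-monomial : ∀ k z → eval (monomial k) z ≡ z ^ k
eval-monomial zero    z = cong suc (*-zeroʳ z)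
eval-monomial (suc k) z = cong (z *_) (eval-monomial k z)

eval-sumₚ-monomial-1 : ∀ (xs : List X) (f : X → ℕ) → eval (sumₚ xs (monomial ∘ f)) 1 ≡ length xs
eval-sumₚ-monomial-1 []       f = refl
eval-sumₚ-monomial-1 (x ∷ xs) f = begin
  eval (monomial (f x) +ₚ sumₚ xs (monomial ∘ f)) 1           ≡⟨ eval-+ₚ (monomial (f x)) _ 1 ⟩
  eval (monomial (f x)) 1 + eval (sumₚ xs (monomial ∘ f)) 1   ≡⟨ cong₂ _+_ (trans (eval-monomial (f x) 1) (^-zeroˡ (f x)))
                                                                          (eval-sumₚ-monomial-1 xs f) ⟩
  1 + length xs                                               ∎
  where open ≡-Reasoning

DegreeAtMost-monomial : ∀ {k d} → k ≤ d → DegreeAtMost (monomial k) d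
DegreeAtMost-monomial {zero}  _         zero    ()
DegreeAtMost-monomial {zero}  _         (suc j) _         = refl
DegreeAtMost-monomial {suc k} (s≤s k≤d) (suc j) (s≤s d<j) = DegreeAtMost-monomial k≤d j d<j

DegreeAtMost-sumₚ : ∀ (xs : List X) {f : X → Poly} {d} →
                    (∀ x → DegreeAtMost (f x) d) → DegreeAtMost (sumₚ xs f) d
DegreeAtMost-sumₚ []       deg k d<k = refl
DegreeAtMost-sumₚ (x ∷ xs) {f} deg k d<k =
  trans (coeff-+ₚ (f x) _ k) (cong₂ _+_ (deg x k d<k) (DegreeAtMost-sumₚ xs deg k d<k))

∈-allSubsets : ∀ {n} (X : Subset n) → X ∈ allSubsets n
∈-allSubsets []      = here refl
∈-allSubsets (x ∷ X) = ∈-concatMap⁺ _ (Any.map (λ { refl → x∷-∈-pair x }) (∈-allSubsets X))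
  where
  x∷-∈-pair : ∀ x → x ∷ X ∈ (false ∷ X) ∷ (true ∷ X) ∷ []
  x∷-∈-pair false = here refl
  x∷-∈-pair true  = there (here refl)

length-pairs : ∀ (xs : List X) (a b : X → Y) → length (concatMap (λ x → a x ∷ b x ∷ []) xs) ≡ 2 * length xs
length-pairs []       a b = refl
length-pairs (x ∷ xs) a b = trans (cong (2 +_) (length-pairs xs a b)) (sym (*-suc 2 (length xs)))

length-allSubsets : ∀ n → length (allSubsets n) ≡ 2 ^ n
length-allSubsets zero    = refl
length-allSubsets (suc n) = trans (length-pairs (allSubsets n) _ _) (cong (2 *_) (length-allSubsets n))

sumₚ-allSubsets-++ : ∀ n m (h : Subset (n + m) → Poly) →
  sumₚ (allSubsets (n + m)) h ≋ sumₚ (allSubsets n) (λ A → sumₚ (allSubsets m) (λ B → h (A ++ᵥ B)))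
sumₚ-allSubsets-++ zero    m h rewrite +ₚ-identityʳ (sumₚ (allSubsets m) h) = ≋-refl
sumₚ-allSubsets-++ (suc n) m h = begin
  sumₚ (allSubsets (suc n + m)) h
    ≈⟨ sumₚ-pairs (allSubsets (n + m)) (false ∷_) (true ∷_) h ⟩
  sumₚ (allSubsets (n + m)) (h ∘ (false ∷_)) +ₚ sumₚ (allSubsets (n + m)) (h ∘ (true ∷_))
    ≈⟨ +ₚ-cong (sumₚ-allSubsets-++ n m (h ∘ (false ∷_))) (sumₚ-allSubsets-++ n m (h ∘ (true ∷_))) ⟩
  sumₚ (allSubsets n) (inner ∘ (false ∷_)) +ₚ sumₚ (allSubsets n) (inner ∘ (true ∷_))
    ≈⟨ sumₚ-pairs (allSubsets n) (false ∷_) (true ∷_) inner ⟨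
  sumₚ (allSubsets (suc n)) inner ∎
  where
  open ≋-Reasoning
  inner : Subset (suc n) → Poly
  inner A = sumₚ (allSubsets m) (λ B → h (A ++ᵥ B))

take-++ᵥ : ∀ {n m} (xs : Subset n) (ys : Subset m) → take n (xs ++ᵥ ys) ≡ xs
take-++ᵥ []       ys = refl
take-++ᵥ (x ∷ xs) ys rewrite take-++ᵥ xs ys = refl

drop-++ᵥ : ∀ {n m} (xs : Subset n) (ys : Subset m) → drop n (xs ++ᵥ ys) ≡ ys
drop-++ᵥ []       ys = refl
drop-++ᵥ (x ∷ xs) ys rewrite drop-++ᵥ xs ys = refl

∣-++ᵥ-∣ : ∀ {n m} (xs : Subset n) (ys : Subset m) → ∣ xs ++ᵥ ys ∣ ≡ ∣ xs ∣ + ∣ ys ∣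
∣-++ᵥ-∣ []           ys = refl
∣-++ᵥ-∣ (true  ∷ xs) ys = cong suc (∣-++ᵥ-∣ xs ys)
∣-++ᵥ-∣ (false ∷ xs) ys = ∣-++ᵥ-∣ xs ys

∣∣≡∣take∣+∣drop∣ : ∀ n {m} (X : Subset (n + m)) → ∣ X ∣ ≡ ∣ take n X ∣ + ∣ drop n X ∣
∣∣≡∣take∣+∣drop∣ n X = trans (cong ∣_∣ (sym (take++drop≡id n X))) (∣-++ᵥ-∣ (take n X) (drop n X))

Δ-⊥ : ∀ {n} (X : Subset n) → X Δ ⊥ ≡ X
Δ-⊥ []      = refl
Δ-⊥ (x ∷ X) = cong₂ _∷_ (xor-identityʳ x) (Δ-⊥ X)

Δ-cancelʳ : ∀ {n} (X Y : Subset n) → (X Δ Y) Δ Y ≡ X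
Δ-cancelʳ []      []      = refl
Δ-cancelʳ (x ∷ X) (y ∷ Y) = cong₂ _∷_ xor-cancelʳ (Δ-cancelʳ X Y)
  where
  xor-cancelʳ : (x xor y) xor y ≡ x
  xor-cancelʳ = trans (xor-assoc x y y) (trans (cong (x xor_) (xor-same y)) (xor-identityʳ x))

lookup-Δ⁅⁆ : ∀ {n} (X : Subset n) e → lookup (X Δ ⁅ e ⁆) e ≡ not (lookup X e)
lookup-Δ⁅⁆ (true  ∷ X) zero    = refl
lookup-Δ⁅⁆ (false ∷ X) zero    = refl
lookup-Δ⁅⁆ (x     ∷ X) (suc e) = lookup-Δ⁅⁆ X e

++-Δ⁅↑ˡ⁆ : ∀ {n m} (xs : Subset n) (ys : Subset m) i → (xs ++ᵥ ys) Δ ⁅ i ↑ˡ m ⁆ ≡ (xs Δ ⁅ i ⁆) ++ᵥ ys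
++-Δ⁅↑ˡ⁆ (x ∷ xs) ys zero    = cong (_ ∷_) (trans (Δ-⊥ (xs ++ᵥ ys)) (cong (_++ᵥ ys) (sym (Δ-⊥ xs))))
++-Δ⁅↑ˡ⁆ (x ∷ xs) ys (suc i) = cong (_ ∷_) (++-Δ⁅↑ˡ⁆ xs ys i)

++-Δ⁅↑ʳ⁆ : ∀ {n m} (xs : Subset n) (ys : Subset m) j → (xs ++ᵥ ys) Δ ⁅ n ↑ʳ j ⁆ ≡ xs ++ᵥ (ys Δ ⁅ j ⁆)
++-Δ⁅↑ʳ⁆ []       ys j = refl
++-Δ⁅↑ʳ⁆ (x ∷ xs) ys j = cong₂ _∷_ (xor-identityʳ x) (++-Δ⁅↑ʳ⁆ xs ys j)

module _ {n} (D : SetSystem n) where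

  sizesAmong : List (Subset n) → List ℕ
  sizesAmong = foldr (λ X acc → if feasible D X then ∣ X ∣ ∷ acc else acc) []

  ∈-sizesAmong⁺ : ∀ {X Xs} → X ∈ Xs → feasible D X ≡ true → ∣ X ∣ ∈ sizesAmong Xs
  ∈-sizesAmong⁺ {Xs = Y ∷ Xs} (here refl) X∈D rewrite X∈D = here refl
  ∈-sizesAmong⁺ {Xs = Y ∷ Xs} (there X∈Xs) X∈D with feasible D Y
  ... | true  = there (∈-sizesAmong⁺ X∈Xs X∈D)
  ... | false = ∈-sizesAmong⁺ X∈Xs X∈D

  ∈-sizesAmong⁻ : ∀ {k} Xs → k ∈ sizesAmong Xs → ∃ λ X → feasible D X ≡ true × ∣ X ∣ ≡ k
  ∈-sizesAmong⁻ (Y ∷ Xs) k∈ with feasible D Y in Y∈D | k∈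
  ... | true  | here k≡∣Y∣  = Y , Y∈D , sym k≡∣Y∣
  ... | true  | there k∈′  = ∈-sizesAmong⁻ Xs k∈′
  ... | false | k∈′        = ∈-sizesAmong⁻ Xs k∈′

  maxFeasible-upper : ∀ {X} → feasible D X ≡ true → ∣ X ∣ ≤ maxFeasible D
  maxFeasible-upper {X} X∈D = foldr-preservesᵒ
    (λ x y → [ m≤n⇒m≤n⊔o y , m≤n⇒m≤o⊔n x ]) 0 (feasibleSizes D)
    (inj₂ (Any.map ≤-reflexive (∈-sizesAmong⁺ (∈-allSubsets X) X∈D)))

  minFeasible-lower : ∀ {X} → feasible D X ≡ true → minFeasible D ≤ ∣ X ∣
  minFeasible-lower {X} X∈D = foldr-preservesᵒ
    (λ x y → [ m≤n⇒m⊓o≤n y , m≤n⇒o⊓m≤n x ]) n (feasibleSizes D)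
    (inj₂ (Any.map (≤-reflexive ∘ sym) (∈-sizesAmong⁺ (∈-allSubsets X) X∈D)))

  -- Both folds are selective: the result is a feasible size unless it is the
  -- start value, which a nonempty system then attains anyway.
  maxFeasible-attained : NonEmpty D → ∃ λ X → feasible D X ≡ true × ∣ X ∣ ≡ maxFeasible D
  maxFeasible-attained (X , X∈D) with foldr-selective ⊔-sel 0 (feasibleSizes D)
  ... | inj₂ max∈ = ∈-sizesAmong⁻ (allSubsets n) max∈
  ... | inj₁ max≡0 = X , X∈D , trans (n≤0⇒n≡0 (subst (∣ X ∣ ≤_) max≡0 (maxFeasible-upper X∈D))) (sym max≡0)

  minFeasible-attained : NonEmpty D → ∃ λ X → feasible D X ≡ true × ∣ X ∣ ≡ minFeasible D
  minFeasible-attained (X , X∈D) with foldr-selective ⊓-sel n (feasibleSizes D)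
  ... | inj₂ min∈ = ∈-sizesAmong⁻ (allSubsets n) min∈
  ... | inj₁ min≡n = X , X∈D , trans (≤-antisym (∣p∣≤n X) (subst (_≤ ∣ X ∣) min≡n (minFeasible-lower X∈D))) (sym min≡n)

  maxFeasible≤n : maxFeasible D ≤ n
  maxFeasible≤n with foldr-selective ⊔-sel 0 (feasibleSizes D)
  ... | inj₁ max≡0 = subst (_≤ n) (sym max≡0) z≤n
  ... | inj₂ max∈ with ∈-sizesAmong⁻ (allSubsets n) max∈
  ...   | X , _ , ∣X∣≡max = subst (_≤ n) ∣X∣≡max (∣p∣≤n X)

  width≤n : width D ≤ n
  width≤n = ≤-trans (m∸n≤m (maxFeasible D) (minFeasible D)) maxFeasible≤n

  minFeasible≤maxFeasible : NonEmpty D → minFeasible D ≤ maxFeasible D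
  minFeasible≤maxFeasible (X , X∈D) = ≤-trans (minFeasible-lower X∈D) (maxFeasible-upper X∈D)

  maxFeasible-unique : ∀ {X k} → feasible D X ≡ true → ∣ X ∣ ≡ k →
                       (∀ Y → feasible D Y ≡ true → ∣ Y ∣ ≤ k) → maxFeasible D ≡ k
  maxFeasible-unique {X} X∈D ∣X∣≡k bound with maxFeasible-attained (X , X∈D)
  ... | Z , Z∈D , ∣Z∣≡max = ≤-antisym (subst (_≤ _) ∣Z∣≡max (bound Z Z∈D))
                                      (subst (_≤ maxFeasible D) ∣X∣≡k (maxFeasible-upper X∈D))

  minFeasible-unique : ∀ {X k} → feasible D X ≡ true → ∣ X ∣ ≡ k →
                       (∀ Y → feasible D Y ≡ true → k ≤ ∣ Y ∣) → minFeasible D ≡ k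
  minFeasible-unique {X} X∈D ∣X∣≡k bound with minFeasible-attained (X , X∈D)
  ... | Z , Z∈D , ∣Z∣≡min = ≤-antisym (subst (minFeasible D ≤_) ∣X∣≡k (minFeasible-lower X∈D))
                                      (subst (_ ≤_) ∣Z∣≡min (bound Z Z∈D))

-- A record for the same reason as _≋_.
infix 4 _≐_
record _≐_ {n} (D D′ : SetSystem n) : Set where
  constructor samePointwise
  field feasible-≡ : ∀ X → feasible D X ≡ feasible D′ X

≐-refl : ∀ {n} {D : SetSystem n} → D ≐ D
≐-refl = samePointwise λ _ → refl

≐-reflexive : ∀ {n} {D D′ : SetSystem n} → D ≡ D′ → D ≐ D′
≐-reflexive refl = ≐-refl

≐-trans : ∀ {n} {D D′ D″ : SetSystem n} → D ≐ D′ → D′ ≐ D″ → D ≐ D″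
≐-trans (samePointwise D≐D′) (samePointwise D′≐D″) = samePointwise λ X → trans (D≐D′ X) (D′≐D″ X)

width-cong : ∀ {n} {D D′ : SetSystem n} → D ≐ D′ → width D ≡ width D′
width-cong {n} (samePointwise D≐D′) = cong (λ sizes → foldr _⊔_ 0 sizes ∸ foldr _⊓_ n sizes)
  (foldr-cong (λ X acc → cong (λ b → if b then ∣ X ∣ ∷ acc else acc) (D≐D′ X)) refl (allSubsets n))

feasible-⊕-++ : ∀ {n m} (D : SetSystem n) (D′ : SetSystem m) X Y →
                feasible (D ⊕ D′) (X ++ᵥ Y) ≡ feasible D X ∧ feasible D′ Y
feasible-⊕-++ D D′ X Y = cong₂ (λ X′ Y′ → feasible D X′ ∧ feasible D′ Y′) (take-++ᵥ X Y) (drop-++ᵥ X Y)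

module _ {n m} (D : SetSystem n) (D′ : SetSystem m) (ne : NonEmpty D) (ne′ : NonEmpty D′) where

  maxFeasible-⊕ : maxFeasible (D ⊕ D′) ≡ maxFeasible D + maxFeasible D′
  maxFeasible-⊕ with maxFeasible-attained D ne | maxFeasible-attained D′ ne′
  ... | X , X∈D , ∣X∣≡max | Y , Y∈D′ , ∣Y∣≡max′ =
    maxFeasible-unique (D ⊕ D′)
      (trans (feasible-⊕-++ D D′ X Y) (cong₂ _∧_ X∈D Y∈D′))
      (trans (∣-++ᵥ-∣ X Y) (cong₂ _+_ ∣X∣≡max ∣Y∣≡max′))
      (λ Z Z∈D⊕D′ → subst (_≤ _) (sym (∣∣≡∣take∣+∣drop∣ n Z))
        (+-mono-≤ (maxFeasible-upper D  (∧-conicalˡ _ _ Z∈D⊕D′))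
                  (maxFeasible-upper D′ (∧-conicalʳ _ _ Z∈D⊕D′))))

  minFeasible-⊕ : minFeasible (D ⊕ D′) ≡ minFeasible D + minFeasible D′
  minFeasible-⊕ with minFeasible-attained D ne | minFeasible-attained D′ ne′
  ... | X , X∈D , ∣X∣≡min | Y , Y∈D′ , ∣Y∣≡min′ =
    minFeasible-unique (D ⊕ D′)
      (trans (feasible-⊕-++ D D′ X Y) (cong₂ _∧_ X∈D Y∈D′))
      (trans (∣-++ᵥ-∣ X Y) (cong₂ _+_ ∣X∣≡min ∣Y∣≡min′))
      (λ Z Z∈D⊕D′ → subst (_ ≤_) (sym (∣∣≡∣take∣+∣drop∣ n Z))
        (+-mono-≤ (minFeasible-lower D  (∧-conicalˡ _ _ Z∈D⊕D′))
                  (minFeasible-lower D′ (∧-conicalʳ _ _ Z∈D⊕D′))))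

  width-⊕ : width (D ⊕ D′) ≡ width D + width D′
  width-⊕ = trans (cong₂ _∸_ maxFeasible-⊕ minFeasible-⊕)
                  ([m+n]∸[o+p]≡[m∸o]+[n∸p] (minFeasible≤maxFeasible D ne) (minFeasible≤maxFeasible D′ ne′))
    where
    [m+n]∸[o+p]≡[m∸o]+[n∸p] : ∀ {a b c d} → c ≤ a → d ≤ b → (a + b) ∸ (c + d) ≡ (a ∸ c) + (b ∸ d)
    [m+n]∸[o+p]≡[m∸o]+[n∸p] {a} {b} {c} {d} c≤a d≤b = begin
      (a + b) ∸ (c + d)   ≡⟨ ∸-+-assoc (a + b) c d ⟨
      (a + b) ∸ c ∸ d     ≡⟨ cong (_∸ d) (+-∸-comm b c≤a) ⟩
      (a ∸ c + b) ∸ d     ≡⟨ +-∸-assoc (a ∸ c) d≤b ⟩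
      (a ∸ c) + (b ∸ d)   ∎
      where open ≡-Reasoning

localRule : Op → Bool → Bool → Bool → Bool
localRule star  e∈X X∈D X′∈D = X′∈D
localRule times e∈X X∈D X′∈D = if e∈X then X∈D xor X′∈D else X∈D

feasible-applyOpAt : ∀ {n} o e (D : SetSystem n) X →
  feasible (applyOpAt o e D) X ≡ localRule o (lookup X e) (feasible D X) (feasible D (X Δ ⁅ e ⁆))
feasible-applyOpAt star  e D X = refl
feasible-applyOpAt times e D X = refl

localRule-∧ʳ : ∀ o b p q r → localRule o b (p ∧ r) (q ∧ r) ≡ localRule o b p q ∧ r
localRule-∧ʳ star  b     p q r = refl
localRule-∧ʳ times true  p q r = sym (∧-distribʳ-xor r p q)
localRule-∧ʳ times false p q r = refl

localRule-∧ˡ : ∀ o b p q r → localRule o b (r ∧ p) (r ∧ q) ≡ r ∧ localRule o b p q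
localRule-∧ˡ star  b     p q r = refl
localRule-∧ˡ times true  p q r = sym (∧-distribˡ-xor r p q)
localRule-∧ˡ times false p q r = refl

applyOpAt-cong : ∀ {n} o e {D D′ : SetSystem n} → D ≐ D′ → applyOpAt o e D ≐ applyOpAt o e D′
applyOpAt-cong o e {D} {D′} (samePointwise D≐D′) = samePointwise λ X → begin
  feasible (applyOpAt o e D) X                                           ≡⟨ feasible-applyOpAt o e D X ⟩
  localRule o (lookup X e) (feasible D X) (feasible D (X Δ ⁅ e ⁆))       ≡⟨ cong₂ (localRule o (lookup X e)) (D≐D′ X) (D≐D′ (X Δ ⁅ e ⁆)) ⟩
  localRule o (lookup X e) (feasible D′ X) (feasible D′ (X Δ ⁅ e ⁆))     ≡⟨ feasible-applyOpAt o e D′ X ⟨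
  feasible (applyOpAt o e D′) X                                          ∎
  where open ≡-Reasoning

applyWordAt-cong : ∀ {n} a e {D D′ : SetSystem n} → D ≐ D′ → applyWordAt a e D ≐ applyWordAt a e D′
applyWordAt-cong []      e D≐D′ = D≐D′
applyWordAt-cong (o ∷ a) e D≐D′ = applyWordAt-cong a e (applyOpAt-cong o e D≐D′)

module _ {n} (e : Fin n) (D : SetSystem n) (X : Subset n) where

  feasible-loopCompAt-∉ : lookup X e ≡ false → feasible (loopCompAt e D) X ≡ feasible D X
  feasible-loopCompAt-∉ e∉X rewrite e∉X = refl

  feasible-loopCompAt-∈ : lookup X e ≡ true →
                          feasible (loopCompAt e D) X ≡ feasible D X xor feasible D (X Δ ⁅ e ⁆)
  feasible-loopCompAt-∈ e∈X rewrite e∈X = refl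

NonEmpty-applyOpAt : ∀ {n} o e {D : SetSystem n} → NonEmpty D → NonEmpty (applyOpAt o e D)
NonEmpty-applyOpAt star  e {D} (X , X∈D) = X Δ ⁅ e ⁆ , trans (cong (feasible D) (Δ-cancelʳ X ⁅ e ⁆)) X∈D
NonEmpty-applyOpAt times e {D} (X , X∈D) with lookup X e in e∈X | feasible D (X Δ ⁅ e ⁆) in X′∈D
... | false | _     = X , trans (feasible-loopCompAt-∉ e D X e∈X) X∈D
... | true  | true  = X Δ ⁅ e ⁆ ,
  trans (feasible-loopCompAt-∉ e D (X Δ ⁅ e ⁆) (trans (lookup-Δ⁅⁆ X e) (cong not e∈X))) X′∈D
... | true  | false = X , trans (feasible-loopCompAt-∈ e D X e∈X) (cong₂ _xor_ X∈D X′∈D)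

NonEmpty-applyWordAt : ∀ {n} a e {D : SetSystem n} → NonEmpty D → NonEmpty (applyWordAt a e D)
NonEmpty-applyWordAt []      e ne = ne
NonEmpty-applyWordAt (o ∷ a) e ne = NonEmpty-applyWordAt a e (NonEmpty-applyOpAt o e ne)

actIfIn : ∀ {n} → Word → Subset n → Fin n → SetSystem n → SetSystem n
actIfIn a A e D = if lookup A e then applyWordAt a e D else D

NonEmpty-foldr-actIfIn : ∀ {n} a A (es : List (Fin n)) {D : SetSystem n} →
                         NonEmpty D → NonEmpty (foldr (actIfIn a A) D es)
NonEmpty-foldr-actIfIn a A []       ne = ne
NonEmpty-foldr-actIfIn a A (e ∷ es) ne with lookup A e
... | true  = NonEmpty-applyWordAt a e (NonEmpty-foldr-actIfIn a A es ne)
... | false = NonEmpty-foldr-actIfIn a A es ne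

NonEmpty-applyWordOn : ∀ {n} a A {D : SetSystem n} → NonEmpty D → NonEmpty (applyWordOn a A D)
NonEmpty-applyWordOn {n} a A = NonEmpty-foldr-actIfIn a A (reverse (allFin n))

≐-from-++ : ∀ {n m} {F G : SetSystem (n + m)} →
            (∀ xs ys → feasible F (xs ++ᵥ ys) ≡ feasible G (xs ++ᵥ ys)) → F ≐ G
≐-from-++ {n} {F = F} {G} agree = samePointwise λ X →
  subst (λ Z → feasible F Z ≡ feasible G Z) (take++drop≡id n X) (agree (take n X) (drop n X))

module _ {n m} (D : SetSystem n) (D′ : SetSystem m) where

  applyOpAt-↑ˡ : ∀ o i → applyOpAt o (i ↑ˡ m) (D ⊕ D′) ≐ applyOpAt o i D ⊕ D′
  applyOpAt-↑ˡ o i = ≐-from-++ λ xs ys → begin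
    feasible (applyOpAt o (i ↑ˡ m) (D ⊕ D′)) (xs ++ᵥ ys)
      ≡⟨ feasible-applyOpAt o (i ↑ˡ m) (D ⊕ D′) (xs ++ᵥ ys) ⟩
    localRule o (lookup (xs ++ᵥ ys) (i ↑ˡ m)) (F (xs ++ᵥ ys)) (F ((xs ++ᵥ ys) Δ ⁅ i ↑ˡ m ⁆))
      ≡⟨ cong₂ (λ b Z → localRule o b (F (xs ++ᵥ ys)) (F Z)) (lookup-++ˡ xs ys i) (++-Δ⁅↑ˡ⁆ xs ys i) ⟩
    localRule o (lookup xs i) (F (xs ++ᵥ ys)) (F ((xs Δ ⁅ i ⁆) ++ᵥ ys))
      ≡⟨ cong₂ (localRule o (lookup xs i)) (feasible-⊕-++ D D′ xs ys) (feasible-⊕-++ D D′ (xs Δ ⁅ i ⁆) ys) ⟩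
    localRule o (lookup xs i) (feasible D xs ∧ feasible D′ ys) (feasible D (xs Δ ⁅ i ⁆) ∧ feasible D′ ys)
      ≡⟨ localRule-∧ʳ o (lookup xs i) _ _ _ ⟩
    localRule o (lookup xs i) (feasible D xs) (feasible D (xs Δ ⁅ i ⁆)) ∧ feasible D′ ys
      ≡⟨ cong (_∧ feasible D′ ys) (feasible-applyOpAt o i D xs) ⟨
    feasible (applyOpAt o i D) xs ∧ feasible D′ ys
      ≡⟨ feasible-⊕-++ (applyOpAt o i D) D′ xs ys ⟨
    feasible (applyOpAt o i D ⊕ D′) (xs ++ᵥ ys) ∎
    where
    open ≡-Reasoning
    F = feasible (D ⊕ D′)

  applyOpAt-↑ʳ : ∀ o j → applyOpAt o (n ↑ʳ j) (D ⊕ D′) ≐ D ⊕ applyOpAt o j D′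
  applyOpAt-↑ʳ o j = ≐-from-++ λ xs ys → begin
    feasible (applyOpAt o (n ↑ʳ j) (D ⊕ D′)) (xs ++ᵥ ys)
      ≡⟨ feasible-applyOpAt o (n ↑ʳ j) (D ⊕ D′) (xs ++ᵥ ys) ⟩
    localRule o (lookup (xs ++ᵥ ys) (n ↑ʳ j)) (F (xs ++ᵥ ys)) (F ((xs ++ᵥ ys) Δ ⁅ n ↑ʳ j ⁆))
      ≡⟨ cong₂ (λ b Z → localRule o b (F (xs ++ᵥ ys)) (F Z)) (lookup-++ʳ xs ys j) (++-Δ⁅↑ʳ⁆ xs ys j) ⟩
    localRule o (lookup ys j) (F (xs ++ᵥ ys)) (F (xs ++ᵥ (ys Δ ⁅ j ⁆)))
      ≡⟨ cong₂ (localRule o (lookup ys j)) (feasible-⊕-++ D D′ xs ys) (feasible-⊕-++ D D′ xs (ys Δ ⁅ j ⁆)) ⟩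
    localRule o (lookup ys j) (feasible D xs ∧ feasible D′ ys) (feasible D xs ∧ feasible D′ (ys Δ ⁅ j ⁆))
      ≡⟨ localRule-∧ˡ o (lookup ys j) _ _ _ ⟩
    feasible D xs ∧ localRule o (lookup ys j) (feasible D′ ys) (feasible D′ (ys Δ ⁅ j ⁆))
      ≡⟨ cong (feasible D xs ∧_) (feasible-applyOpAt o j D′ ys) ⟨
    feasible D xs ∧ feasible (applyOpAt o j D′) ys
      ≡⟨ feasible-⊕-++ D (applyOpAt o j D′) xs ys ⟨
    feasible (D ⊕ applyOpAt o j D′) (xs ++ᵥ ys) ∎
    where
    open ≡-Reasoning
    F = feasible (D ⊕ D′)

module _ {n m : ℕ} where

  applyWordAt-↑ˡ : ∀ a i (D : SetSystem n) (D′ : SetSystem m) →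
                   applyWordAt a (i ↑ˡ m) (D ⊕ D′) ≐ applyWordAt a i D ⊕ D′
  applyWordAt-↑ˡ []      i D D′ = ≐-refl
  applyWordAt-↑ˡ (o ∷ a) i D D′ =
    ≐-trans (applyWordAt-cong a (i ↑ˡ m) (applyOpAt-↑ˡ D D′ o i)) (applyWordAt-↑ˡ a i (applyOpAt o i D) D′)

  applyWordAt-↑ʳ : ∀ a j (D : SetSystem n) (D′ : SetSystem m) →
                   applyWordAt a (n ↑ʳ j) (D ⊕ D′) ≐ D ⊕ applyWordAt a j D′
  applyWordAt-↑ʳ []      j D D′ = ≐-refl
  applyWordAt-↑ʳ (o ∷ a) j D D′ =
    ≐-trans (applyWordAt-cong a (n ↑ʳ j) (applyOpAt-↑ʳ D D′ o j)) (applyWordAt-↑ʳ a j D (applyOpAt o j D′))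

  module _ (a : Word) (A : Subset n) (B : Subset m) (D : SetSystem n) (D′ : SetSystem m) where

    foldr-actIfIn-↑ˡ : ∀ is {F : SetSystem (n + m)} → F ≐ D ⊕ D′ →
                       foldr (actIfIn a (A ++ᵥ B)) F (map (_↑ˡ m) is) ≐ foldr (actIfIn a A) D is ⊕ D′
    foldr-actIfIn-↑ˡ []       F≐ = F≐
    foldr-actIfIn-↑ˡ (i ∷ is) F≐ rewrite lookup-++ˡ A B i with lookup A i
    ... | true  = ≐-trans (applyWordAt-cong a (i ↑ˡ m) (foldr-actIfIn-↑ˡ is F≐))
                          (applyWordAt-↑ˡ a i (foldr (actIfIn a A) D is) D′)
    ... | false = foldr-actIfIn-↑ˡ is F≐

    foldr-actIfIn-↑ʳ : ∀ js {F : SetSystem (n + m)} → F ≐ D ⊕ D′ →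
                       foldr (actIfIn a (A ++ᵥ B)) F (map (n ↑ʳ_) js) ≐ D ⊕ foldr (actIfIn a B) D′ js
    foldr-actIfIn-↑ʳ []       F≐ = F≐
    foldr-actIfIn-↑ʳ (j ∷ js) F≐ rewrite lookup-++ʳ A B j with lookup B j
    ... | true  = ≐-trans (applyWordAt-cong a (n ↑ʳ j) (foldr-actIfIn-↑ʳ js F≐))
                          (applyWordAt-↑ʳ a j D (foldr (actIfIn a B) D′ js))
    ... | false = foldr-actIfIn-↑ʳ js F≐

tabulate-+ : ∀ n {m} (f : Fin (n + m) → X) → tabulate f ≡ tabulate (f ∘ (_↑ˡ m)) ++ tabulate (f ∘ (n ↑ʳ_))
tabulate-+ zero    f = refl
tabulate-+ (suc n) f = cong (f zero ∷_) (tabulate-+ n (f ∘ suc))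

reverse-allFin-+ : ∀ n m →
  reverse (allFin (n + m)) ≡ map (n ↑ʳ_) (reverse (allFin m)) ++ map (_↑ˡ m) (reverse (allFin n))
reverse-allFin-+ n m = begin
  reverse (allFin (n + m))
    ≡⟨ cong reverse (tabulate-+ n id) ⟩
  reverse (tabulate (_↑ˡ m) ++ tabulate (n ↑ʳ_))
    ≡⟨ cong reverse (cong₂ _++_ (map-tabulate id (_↑ˡ m)) (map-tabulate id (n ↑ʳ_))) ⟨
  reverse (map (_↑ˡ m) (allFin n) ++ map (n ↑ʳ_) (allFin m))
    ≡⟨ reverse-++ (map (_↑ˡ m) (allFin n)) _ ⟩
  reverse (map (n ↑ʳ_) (allFin m)) ++ reverse (map (_↑ˡ m) (allFin n))
    ≡⟨ cong₂ _++_ (reverse-map (n ↑ʳ_) (allFin m)) (reverse-map (_↑ˡ m) (allFin n)) ⟨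
  map (n ↑ʳ_) (reverse (allFin m)) ++ map (_↑ˡ m) (reverse (allFin n)) ∎
  where open ≡-Reasoning

applyWordOn-⊕ : ∀ {n m} a (A : Subset n) (B : Subset m) (D : SetSystem n) (D′ : SetSystem m) →
                applyWordOn a (A ++ᵥ B) (D ⊕ D′) ≐ applyWordOn a A D ⊕ applyWordOn a B D′
applyWordOn-⊕ {n} {m} a A B D D′ = ≐-trans (≐-reflexive split)
  (foldr-actIfIn-↑ʳ a A B (applyWordOn a A D) D′ (reverse (allFin m))
    (foldr-actIfIn-↑ˡ a A B D D′ (reverse (allFin n)) ≐-refl))
  where
  act = actIfIn a (A ++ᵥ B)
  split : applyWordOn a (A ++ᵥ B) (D ⊕ D′)
        ≡ foldr act (foldr act (D ⊕ D′) (map (_↑ˡ m) (reverse (allFin n)))) (map (n ↑ʳ_) (reverse (allFin m)))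
  split = trans (cong (foldr act (D ⊕ D′)) (reverse-allFin-+ n m))
                (foldr-++ act (D ⊕ D′) (map (n ↑ʳ_) (reverse (allFin m))) (map (_↑ˡ m) (reverse (allFin n))))

width-applyWordOn-⊕ : ∀ {n m} a (D : SetSystem n) (D′ : SetSystem m) → NonEmpty D → NonEmpty D′ → ∀ A B →
  width (applyWordOn a (A ++ᵥ B) (D ⊕ D′)) ≡ width (applyWordOn a A D) + width (applyWordOn a B D′)
width-applyWordOn-⊕ a D D′ ne ne′ A B = trans (width-cong (applyWordOn-⊕ a A B D D′))
  (width-⊕ _ _ (NonEmpty-applyWordOn a A ne) (NonEmpty-applyWordOn a B ne′))

partialPoly-⊕ : ∀ {n m} (D : SetSystem n) (D′ : SetSystem m) a → NonEmpty D → NonEmpty D′ →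
                partialPoly (D ⊕ D′) a ≋ (partialPoly D a *ₚ partialPoly D′ a)
partialPoly-⊕ {n} {m} D D′ a ne ne′ = begin
  partialPoly (D ⊕ D′) a
    ≈⟨ sumₚ-allSubsets-++ n m (λ C → monomial (width (applyWordOn a C (D ⊕ D′)))) ⟩
  sumₚ (allSubsets n) (λ A → sumₚ (allSubsets m) (λ B → monomial (width (applyWordOn a (A ++ᵥ B) (D ⊕ D′)))))
    ≈⟨ sumₚ-cong (allSubsets n) (λ A → sumₚ-cong (allSubsets m) (λ B →
         ≋-reflexive (cong monomial (width-applyWordOn-⊕ a D D′ ne ne′ A B)))) ⟩
  sumₚ (allSubsets n) (λ A → sumₚ (allSubsets m) (λ B → monomial (w A + w′ B)))
    ≈⟨ sumₚ-monomial-*ₚ (allSubsets n) (allSubsets m) w w′ ⟨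
  partialPoly D a *ₚ partialPoly D′ a ∎
  where
  open ≋-Reasoning
  w  = λ A → width (applyWordOn a A D)
  w′ = λ B → width (applyWordOn a B D′)

mainTheorem1 : ∀ {n m} (D : SetSystem n) (D' : SetSystem m) (a : Word) →
    (eval (partialPoly D a) 1 ≡ 2 ^ n)
    × DegreeAtMost (partialPoly D a) n
    × (NonEmpty D → NonEmpty D' →
         partialPoly (D ⊕ D') a ≈ₚ (partialPoly D a *ₚ partialPoly D' a))
mainTheorem1 {n} D D' a =
    trans (eval-sumₚ-monomial-1 (allSubsets n) _) (length-allSubsets n)
  , DegreeAtMost-sumₚ (allSubsets n) (λ A → DegreeAtMost-monomial (width≤n (applyWordOn a A D)))
  , λ ne ne' → ≋⇒≈ₚ (partialPoly-⊕ D D' a ne ne')
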